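{- Let $M$ be an inductively connected elementary split matroid of rank $n$ on $d$ points, and let $w=(p_1,\ldots,p_d)$ be an ordering of its points such that $\{p_1,\ldots,p_n\}$ is a basis of $M$ and $|(\mathcal{L}_w[i])_{p_i}|\leq 2$ for all $n<i\leq d$. Then $$\sum_{i=1}^d\widetilde{\tau}_i=\dim_{\mathrm{naive}}(\Gamma_M).$$
   Context: Subspaces of a matroid $N$ of rank $k$: circuits of size at most $k$ grouped by $C_1\sim C_2\iff\mathrm{cl}(C_1)=\mathrm{cl}(C_2)$; each class $l$ is a subspace, $\mathrm{rank}(l)$ is the rank of its circuits, $l$ is identified with the set of points lying in some circuit of the class, $|l|$ its cardinality; $\mathcal{L}_N$ is the set of subspaces. Naive dimension: $\dim_{\mathrm{naive}}(\Gamma_M)=nd-\sum_{l\in\mathcal{L}_M}(|l|-\mathrm{rank}(l))(n-\mathrm{rank}(l))$. $M_w[i]$ is the restriction of $M$ to $\{p_1,\ldots,p_i\}$ and $(\mathcal{L}_w[i])_{p_i}$ is the set of subspaces of $M_w[i]$ containing $p_i$. Set $\tau_i=\sum_{l\in(\mathcal{L}_w[i])_{p_i}}\mathrm{rank}(l)-n(|(\mathcal{L}_w[i])_{p_i}|-1)$, and $\widetilde{\tau}_i=\tau_i$ if $|(\mathcal{L}_w[i])_{p_i}|\leq1$, while $\widetilde{\tau}_i=\mathrm{rank}(l_1)+\mathrm{rank}(l_2)-\mathrm{rank}(l_1\cup l_2)$ if $(\mathcal{L}_w[i])_{p_i}=\{l_1,l_2\}$. $M$ is inductively connected if such an ordering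 exists. Elementary split matroid: for $H_1,\ldots,H_q\subseteq[d]$ and positive integers $r_i$ with $|H_i\cap H_j|\leq r_i+r_j-n$ ($i\neq j$), $|[d]\setminus H_i|\geq n-r_i$, $r_i\leq n-1$, $|H_i|\geq r_i+1$, the rank-$n$ matroid with independent sets $\{X:|X|\leq n,\ |X\cap H_i|\leq r_i\ \forall i\}$. -}

module Defs where

open import Data.Nat as ℕ using (ℕ; zero; suc; _≤ᵇ_; _<ᵇ_; _≡ᵇ_; _≤_; _<_; _⊔_)
open import Data.Bool as B using (Bool; true; false; _∧_; _∨_; not; T)
open import Data.Fin as F using (Fin; toℕ)
open import Data.Fin.Subset using (Subset; ∣_∣; _∩_; _∪_; _─_; _-_; ⁅_⁆; ⋃; ∁; _∉_)
open import Data.Vec as V using (Vec; []; _∷_; lookup; tabulate)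
open import Data.Vec.Properties using (≡-dec)
open import Data.List as L using (List; []; _∷_; _++_; map; filterᵇ; foldr; length; allFin; deduplicate)
open import Data.Integer as ℤ using (ℤ; +_)
open import Data.Product using (_×_; _,_; proj₁; proj₂; Σ; ∃)
open import Relation.Binary.PropositionalEquality using (_≡_; _≢_)
open import Function.Definitions using (Injective)
open import Relation.Nullary using (does)

allSubsets : (d : ℕ) → List (Subset d)
allSubsets zero = [] ∷ []
allSubsets (suc d) = map (true ∷_) (allSubsets d) ++ map (false ∷_) (allSubsets d)

_∈ᵇ_ : ∀ {d} → Fin d → Subset d → Bool
x ∈ᵇ X = lookup X x

_⊆ᵇ_ : ∀ {d} → Subset d → Subset d → Bool
X ⊆ᵇ Y = ∣ X ─ Y ∣ ≡ᵇ 0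

allᵇ : ∀ {A : Set} → (A → Bool) → List A → Bool
allᵇ p = foldr (λ x b → p x ∧ b) true

sumℤ : List ℤ → ℤ
sumℤ = foldr ℤ._+_ (+ 0)

module MatroidOps {d : ℕ} (indep : Subset d → Bool) where

  rank : Subset d → ℕ
  rank X = foldr _⊔_ 0 (map ∣_∣ (filterᵇ (λ Y → (Y ⊆ᵇ X) ∧ indep Y) (allSubsets d)))

  isCircuit : Subset d → Bool
  isCircuit C = not (indep C) ∧ allᵇ (λ x → not (x ∈ᵇ C) ∨ indep (C - x)) (allFin d)

  -- closure in the restriction M|S  (cl_{M|S}(X) = cl_M(X) ∩ S)
  cl : Subset d → Subset d → Subset d
  cl S X = tabulate (λ x → (x ∈ᵇ S) ∧ (rank (X ∪ ⁅ x ⁆) ≡ᵇ rank X))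

  smallCircuits : Subset d → List (Subset d)
  smallCircuits S =
    filterᵇ (λ C → (C ⊆ᵇ S) ∧ isCircuit C ∧ (∣ C ∣ ≤ᵇ rank S)) (allSubsets d)

  -- one representative circuit for each class C₁ ∼ C₂ ⇔ cl(C₁) = cl(C₂)
  classReps : Subset d → List (Subset d)
  classReps S = deduplicate (λ C D → ≡-dec B._≟_ (cl S C) (cl S D)) (smallCircuits S)

  classPoints : Subset d → Subset d → Subset d
  classPoints S C =
    ⋃ (filterᵇ (λ D → does (≡-dec B._≟_ (cl S D) (cl S C))) (smallCircuits S))

  -- the subspaces of M|S, each as (point set l , rank(l)), where rank(l)
  -- is the rank of the circuits of the class
  subspaces : Subset d → List (Subset d × ℕ)
  subspaces S = map (λ C → classPoints S C , rank C) (classReps S)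

  full : Subset d
  full = tabulate (λ _ → true)

  -- naive dimension of Γ_M, with n the rank (ambient dimension)
  naiveDim : ℕ → ℤ
  naiveDim n = + (n ℕ.* d) ℤ.-
    sumℤ (map (λ l → (+ ∣ proj₁ l ∣ ℤ.- + proj₂ l) ℤ.* (+ n ℤ.- + proj₂ l)) (subspaces full))

  IsBasis : Subset d → Set
  IsBasis B = T (indep B) × (∀ x → x ∉ B → indep (B ∪ ⁅ x ⁆) ≡ false)

  -- Orderings w = (p₁,…,p_d), stored 0-indexed: p_{j+1} = w j.

  firstPoints : (Fin d → Fin d) → ℕ → Subset d
  firstPoints w m = ⋃ (map (λ k → ⁅ w k ⁆) (filterᵇ (λ k → toℕ k <ᵇ m) (allFin d)))

  -- ground set of M_w[i] for i = j+1, i.e. {p₁,…,p_i}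
  prefix : (Fin d → Fin d) → Fin d → Subset d
  prefix w j = firstPoints w (suc (toℕ j))

  -- (L_w[i])_{p_i} for i = j+1
  Lp : (Fin d → Fin d) → Fin d → List (Subset d × ℕ)
  Lp w j = filterᵇ (λ l → w j ∈ᵇ proj₁ l) (subspaces (prefix w j))

  τ : ℕ → (Fin d → Fin d) → Fin d → ℤ
  τ n w j = sumℤ (map (λ l → + proj₂ l) (Lp w j))
            ℤ.- (+ n) ℤ.* (+ length (Lp w j) ℤ.- + 1)

  τ̃ : ℕ → (Fin d → Fin d) → Fin d → ℤ
  τ̃ n w j with Lp w j
  ... | l₁ ∷ l₂ ∷ [] = + proj₂ l₁ ℤ.+ + proj₂ l₂ ℤ.- + rank (proj₁ l₁ ∪ proj₁ l₂)
  ... | _ = τ n w j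

  GoodOrdering : ℕ → (Fin d → Fin d) → Set
  GoodOrdering n w = Injective _≡_ _≡_ w
                   × IsBasis (firstPoints w n)
                   × (∀ (j : Fin d) → n ≤ toℕ j → length (Lp w j) ≤ 2)

  InductivelyConnected : ℕ → Set
  InductivelyConnected n = ∃ λ (w : Fin d → Fin d) → GoodOrdering n w

record ElementarySplitData (d n : ℕ) : Set where
  field
    q   : ℕ
    H   : Fin q → Subset d
    r   : Fin q → ℕ
    r-pos   : ∀ i → 1 ≤ r i
    H-inter : ∀ i j → i ≢ j → ∣ H i ∩ H j ∣ ℕ.+ n ≤ r i ℕ.+ r j
    H-compl : ∀ i → n ≤ ∣ ∁ (H i) ∣ ℕ.+ r i
    r-bound : ∀ i → r i < n
    H-size  : ∀ i → r i < ∣ H i ∣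

  indep : Subset d → Bool
  indep X = (∣ X ∣ ≤ᵇ n) ∧ allᵇ (λ i → ∣ X ∩ H i ∣ ≤ᵇ r i) (allFin q)

{-# OPTIONS --safe #-}
module Submission where

-- In an elementary split matroid the circuits of size at most n are the (r i + 1)-subsets of the
-- H i, and their closure in a restriction M|S is H i ∩ S. Hence if S has rank n the subspaces of
-- M|S are the sets H i ∩ S with more than r i points, of rank r i, while the restrictions to the
-- first n points of w, which form a basis, have none. Two distinct such subspaces span, because
-- |H i ∩ H k| ≤ r i + r k − n; so with at most two subspaces through p_i we always have
-- τ̃_i = n − Σ (n − rank l), the sum over the subspaces l through p_i. Summing over i and exchanging
-- the sums, H i contributes n − r i once for each of its points that comes after the first r i of
-- them in the ordering, that is |H i| − r i times: exactly its term in the naive dimension.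

open import Defs
open import Data.Nat using (ℕ; _≤_; _<_)
open import Data.Fin using (Fin; toℕ)
open import Data.Integer using (ℤ)
open import Data.List using (map; allFin)
open import Relation.Binary.PropositionalEquality using (_≡_)

import Data.Bool as Bool
open import Data.Bool.Base using (Bool; true; false; T; not; _∧_; if_then_else_)
open import Data.Bool.Properties using (T-≡; T-∧; T-∨; T?; ∧-comm; ∧-zeroʳ; ∧-identityʳ; if-∧)
open import Data.Empty using (⊥-elim)
import Data.Fin as Fin
open import Data.Fin.Properties using (¬∀⟶∃¬; toℕ-injective; toℕ-fromℕ<)
open import Data.Fin.Subset
  using (Subset; inside; outside; _∈_; _∉_; _⊆_; ∣_∣; _∩_; _∪_; _─_; _-_; ⁅_⁆; ⊤; ⊥; ⋃; Nonempty)
open import Data.Fin.Subset.Properties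
import Data.Integer as ℤ
import Data.Integer.Properties as ℤ
open import Data.Integer.Tactic.RingSolver using (solve-∀)
open import Data.List.Base using (List; []; _∷_; length; foldr; tabulate; filter; filterᵇ; deduplicate)
open import Data.List.Membership.Propositional as List using (find)
open import Data.List.Membership.Propositional.Properties
  using (∈-map⁺; ∈-map⁻; ∈-filter⁺; ∈-filter⁻; ∈-allFin; ∈-++⁺ˡ; ∈-++⁺ʳ; ∈-deduplicate⁻)
open import Data.List.Membership.Propositional.Properties.WithK using (unique∧set⇒bag)
open import Data.List.Properties
  using (filter-none; filter-all; map-cong; map-∘; map-tabulate; length-tabulate;
         foldr-preservesᵇ; foldr-preservesᵒ)
open import Data.List.Relation.Binary.BagAndSetEquality using (∼bag⇒↭)
open import Data.List.Relation.Binary.Permutation.Propositional using (_↭_; ↭-refl; ↭⇒↭ₛ)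
open import Data.List.Relation.Binary.Permutation.Propositional.Properties using (map⁺; filter-↭)
open import Data.List.Relation.Binary.Permutation.Setoid.Properties using (foldr-commMonoid)
open import Data.List.Relation.Unary.All as All using (All; []; _∷_)
import Data.List.Relation.Unary.All.Properties as AllP
open import Data.List.Relation.Unary.All.Properties using (all-filter)
open import Data.List.Relation.Unary.AllPairs as AllPairs using (AllPairs; []; _∷_)
open import Data.List.Relation.Unary.Any as Any using (Any)
import Data.List.Relation.Unary.Any.Properties as AnyP
open import Data.List.Relation.Unary.Unique.DecSetoid.Properties using (deduplicate-!)
open import Data.List.Relation.Unary.Unique.Propositional using (Unique)
import Data.List.Relation.Unary.Unique.Propositional.Properties as Unique
import Data.Nat as ℕ
open import Data.Nat.Base using (zero; suc; _+_; _*_; _∸_; _⊔_; z≤n; s≤s; s≤s⁻¹; _≡ᵇ_; _≤ᵇ_; _<ᵇ_)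
open import Data.Nat.Properties
open import Algebra.Properties.CommutativeSemigroup +-commutativeSemigroup using (interchange; xy∙z≈y∙zx)
open import Data.Product using (_×_; _,_; proj₁; proj₂; ∃)
open import Data.Sum using (_⊎_; inj₁; inj₂; [_,_]′)
open import Data.Vec.Base as Vec using ([]; _∷_; lookup)
open import Data.Vec.Properties
  using (≡-dec; lookup∘tabulate; []=⇒lookup; lookup⇒[]=; lookup-zipWith; tabulate-cong; tabulate∘lookup)
open import Function using (_∘_; id; _⇔_; Equivalence; mk⇔)
open import Function.Definitions using (Injective)
import Relation.Binary.Construct.On as On
import Relation.Binary.PropositionalEquality as ≡
open import Relation.Binary.PropositionalEquality
  using (_≢_; refl; sym; trans; cong; cong₂; subst; subst₂; module ≡-Reasoning)
open import Relation.Nullary using (Dec; yes; no; ¬_; does; contradiction)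
open import Relation.Nullary.Decidable using (dec-true; dec-false)
open import Relation.Unary using (Decidable)

open Equivalence using (to; from)

T-not⇒¬T : ∀ {b} → T (not b) → ¬ T b
T-not⇒¬T {false} _ ()

¬T⇒T-not : ∀ {b} → ¬ T b → T (not b)
¬T⇒T-not {false} _  = _
¬T⇒T-not {true}  ¬t = ¬t _

T-injective : ∀ {a b} → T a ⇔ T b → a ≡ b
T-injective {false} {false} _   = refl
T-injective {false} {true}  a⇔b = ⊥-elim (from a⇔b _)
T-injective {true}  {false} a⇔b = ⊥-elim (to a⇔b _)
T-injective {true}  {true}  _   = refl

T-does⁻ : ∀ {A : Set} (a? : Dec A) → T (does a?) → A
T-does⁻ (yes a) _ = a

T-does⁺ : ∀ {A : Set} (a? : Dec A) → A → T (does a?)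
T-does⁺ (yes _) _ = _
T-does⁺ (no ¬a) a = ¬a a

≤-foldr-⊔ : ∀ {m xs} → m List.∈ xs → m ≤ foldr _⊔_ 0 xs
≤-foldr-⊔ m∈xs =
  foldr-preservesᵒ (λ x y → [ m≤n⇒m≤n⊔o y , m≤n⇒m≤o⊔n x ]′) 0 _ (inj₂ (Any.map ≤-reflexive m∈xs))

foldr-⊔-≤ : ∀ {m xs} → All (_≤ m) xs → foldr _⊔_ 0 xs ≤ m
foldr-⊔-≤ = foldr-preservesᵇ ⊔-lub z≤n

module _ {A : Set} {f : A → Bool} where

  allᵇ⇒All : ∀ xs → T (allᵇ f xs) → All (T ∘ f) xs
  allᵇ⇒All []       _ = []
  allᵇ⇒All (x ∷ xs) t = let fx , fxs = to T-∧ t in fx ∷ allᵇ⇒All xs fxs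

  All⇒allᵇ : ∀ {xs} → All (T ∘ f) xs → T (allᵇ f xs)
  All⇒allᵇ []         = _
  All⇒allᵇ (fx ∷ fxs) = from T-∧ (fx , All⇒allᵇ fxs)

AllPairs-map-within : ∀ {A B : Set} {P : A → Set} {R : A → A → Set} {R′ : B → B → Set} {f : A → B} →
                      (∀ {x y} → P x → P y → R x y → R′ (f x) (f y)) →
                      ∀ {xs} → All P xs → AllPairs R xs → AllPairs R′ (map f xs)
AllPairs-map-within h []         []           = []
AllPairs-map-within h (px ∷ pxs) (rxs ∷ rxss) =
  AllP.map⁺ (All.zipWith (λ (py , rxy) → h px py rxy) (pxs , rxs)) ∷ AllPairs-map-within h pxs rxss

≤-from-budget : ∀ {a b c x y m} → a ≤ b + c → b + m ≤ x + y → c + x ≤ m → a ≤ y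
≤-from-budget {a} {b} {c} {x} {y} {m} a≤b+c b+m≤x+y c+x≤m = +-cancelʳ-≤ (m + x) a y (begin
  a + (m + x)        ≤⟨ +-monoˡ-≤ (m + x) a≤b+c ⟩
  (b + c) + (m + x)  ≡⟨ interchange b c m x ⟩
  (b + m) + (c + x)  ≤⟨ +-mono-≤ b+m≤x+y c+x≤m ⟩
  (x + y) + m        ≡⟨ xy∙z≈y∙zx x y m ⟩
  y + (m + x)        ∎)
  where open ≤-Reasoning

-- Finite subsets

module _ where

  private
    variable
      k : ℕ
      x : Fin k
      p q r : Subset k

  ∈ᵇ⇒∈ : T (x ∈ᵇ p) → x ∈ p
  ∈ᵇ⇒∈ t = lookup⇒[]= _ _ (to T-≡ t)

  ∈⇒∈ᵇ : x ∈ p → T (x ∈ᵇ p)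
  ∈⇒∈ᵇ x∈p = from T-≡ ([]=⇒lookup x∈p)

  x∈p─q⇒x∉q : x ∈ p ─ q → x ∉ q
  x∈p─q⇒x∉q {p = inside ∷ _} {outside ∷ _} Vec.here ()
  x∈p─q⇒x∉q {p = _ ∷ _}      {_ ∷ _}       (Vec.there x∈p─q) (Vec.there x∈q) = x∈p─q⇒x∉q x∈p─q x∈q

  x∈p⇒0<∣p∣ : x ∈ p → 0 < ∣ p ∣
  x∈p⇒0<∣p∣ {p = p} x∈p = ≤-<-trans z≤n (x∈p⇒∣p-x∣<∣p∣ {p = p} x∈p)

  0<∣p∣⇒Nonempty : 0 < ∣ p ∣ → Nonempty p
  0<∣p∣⇒Nonempty {p = inside ∷ _}  _      = Fin.zero , Vec.here
  0<∣p∣⇒Nonempty {p = outside ∷ _} 0<∣p∣ =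
    let x , x∈p = 0<∣p∣⇒Nonempty 0<∣p∣ in Fin.suc x , Vec.there x∈p

  ⊆ᵇ⇒⊆ : T (p ⊆ᵇ q) → p ⊆ q
  ⊆ᵇ⇒⊆ {p = p} {q = q} t {x} x∈p with x ∈? q
  ... | yes x∈q = x∈q
  ... | no  x∉q = ⊥-elim (<⇒≢ (x∈p⇒0<∣p∣ (x∈p∧x∉q⇒x∈p─q x∈p x∉q)) (sym (≡ᵇ⇒≡ _ 0 t)))

  p⊆q⇒∣p─q∣≡0 : p ⊆ q → ∣ p ─ q ∣ ≡ 0
  p⊆q⇒∣p─q∣≡0 {k} {p} {q} p⊆q = n≤0⇒n≡0 (≤-trans (p⊆q⇒∣p∣≤∣q∣ p─q⊆⊥) (≤-reflexive (∣⊥∣≡0 k)))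
    where
    p─q⊆⊥ : p ─ q ⊆ ⊥
    p─q⊆⊥ x∈p─q = ⊥-elim (x∈p─q⇒x∉q x∈p─q (p⊆q (p─q⊆p p q x∈p─q)))

  ⊆⇒⊆ᵇ : p ⊆ q → T (p ⊆ᵇ q)
  ⊆⇒⊆ᵇ = ≡⇒≡ᵇ _ 0 ∘ p⊆q⇒∣p─q∣≡0

  ∣p∣≡∣p∩q∣+∣p─q∣ : ∀ (p q : Subset k) → ∣ p ∣ ≡ ∣ p ∩ q ∣ + ∣ p ─ q ∣
  ∣p∣≡∣p∩q∣+∣p─q∣ []            []            = refl
  ∣p∣≡∣p∩q∣+∣p─q∣ (outside ∷ p) (inside ∷ q)  = ∣p∣≡∣p∩q∣+∣p─q∣ p q
  ∣p∣≡∣p∩q∣+∣p─q∣ (outside ∷ p) (outside ∷ q) = ∣p∣≡∣p∩q∣+∣p─q∣ p q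
  ∣p∣≡∣p∩q∣+∣p─q∣ (inside ∷ p)  (inside ∷ q)  = cong suc (∣p∣≡∣p∩q∣+∣p─q∣ p q)
  ∣p∣≡∣p∩q∣+∣p─q∣ (inside ∷ p)  (outside ∷ q) = trans (cong suc (∣p∣≡∣p∩q∣+∣p─q∣ p q)) (sym (+-suc _ _))

  ∣p∩r∣≤∣q∩r∣+∣p─q∣ : ∀ (p q r : Subset k) → ∣ p ∩ r ∣ ≤ ∣ q ∩ r ∣ + ∣ p ─ q ∣
  ∣p∩r∣≤∣q∩r∣+∣p─q∣ p q r = begin
    ∣ p ∩ r ∣                          ≡⟨ ∣p∣≡∣p∩q∣+∣p─q∣ (p ∩ r) q ⟩
    ∣ (p ∩ r) ∩ q ∣ + ∣ (p ∩ r) ─ q ∣  ≤⟨ +-mono-≤ (p⊆q⇒∣p∣≤∣q∣ ⊆q∩r) (p⊆q⇒∣p∣≤∣q∣ ⊆p─q) ⟩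
    ∣ q ∩ r ∣ + ∣ p ─ q ∣              ∎
    where
    open ≤-Reasoning
    ⊆q∩r : (p ∩ r) ∩ q ⊆ q ∩ r
    ⊆q∩r x∈ = let x∈p∩r , x∈q = x∈p∩q⁻ (p ∩ r) q x∈ in x∈p∩q⁺ (x∈q , p∩q⊆q p r x∈p∩r)
    ⊆p─q : (p ∩ r) ─ q ⊆ p ─ q
    ⊆p─q x∈ = x∈p∧x∉q⇒x∈p─q (p∩q⊆p p r (p─q⊆p (p ∩ r) q x∈)) (x∈p─q⇒x∉q x∈)

  x∈p⇒∣p∣≡suc∣p-x∣ : x ∈ p → ∣ p ∣ ≡ suc ∣ p - x ∣
  x∈p⇒∣p∣≡suc∣p-x∣ {x = x} {p = p} x∈p = begin
    ∣ p ∣                     ≡⟨ ∣p∣≡∣p∩q∣+∣p─q∣ p ⁅ x ⁆ ⟩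
    ∣ p ∩ ⁅ x ⁆ ∣ + ∣ p - x ∣ ≡⟨ cong (λ s → ∣ s ∣ + ∣ p - x ∣) p∩⁅x⁆≡⁅x⁆ ⟩
    ∣ ⁅ x ⁆ ∣ + ∣ p - x ∣     ≡⟨ cong (_+ ∣ p - x ∣) (∣⁅x⁆∣≡1 x) ⟩
    suc ∣ p - x ∣             ∎
    where
    open ≡-Reasoning
    p∩⁅x⁆≡⁅x⁆ : p ∩ ⁅ x ⁆ ≡ ⁅ x ⁆
    p∩⁅x⁆≡⁅x⁆ = ⊆-antisym (p∩q⊆q p ⁅ x ⁆)
      (λ y∈⁅x⁆ → x∈p∩q⁺ (subst (_∈ p) (sym (x∈⁅y⁆⇒x≡y x y∈⁅x⁆)) x∈p , y∈⁅x⁆))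

  x∉p⇒∣p∪⁅x⁆∣≡suc∣p∣ : x ∉ p → ∣ p ∪ ⁅ x ⁆ ∣ ≡ suc ∣ p ∣
  x∉p⇒∣p∪⁅x⁆∣≡suc∣p∣ {x = Fin.zero}  {p = inside ∷ _}  x∉p = ⊥-elim (x∉p Vec.here)
  x∉p⇒∣p∪⁅x⁆∣≡suc∣p∣ {x = Fin.zero}  {p = outside ∷ p} _   = cong (suc ∘ ∣_∣) (∪-identityʳ p)
  x∉p⇒∣p∪⁅x⁆∣≡suc∣p∣ {x = Fin.suc _} {p = inside ∷ _}  x∉p = cong suc (x∉p⇒∣p∪⁅x⁆∣≡suc∣p∣ (x∉p ∘ Vec.there))
  x∉p⇒∣p∪⁅x⁆∣≡suc∣p∣ {x = Fin.suc _} {p = outside ∷ _} x∉p = x∉p⇒∣p∪⁅x⁆∣≡suc∣p∣ (x∉p ∘ Vec.there)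

  x∉p⇒∣q∩[p∪⁅x⁆]∣≡∣q∩p∣+[x∈q] : x ∉ p → ∣ q ∩ (p ∪ ⁅ x ⁆) ∣ ≡ ∣ q ∩ p ∣ + (if x ∈ᵇ q then 1 else 0)
  x∉p⇒∣q∩[p∪⁅x⁆]∣≡∣q∩p∣+[x∈q] {x = Fin.zero}  {p = inside ∷ _}  x∉p = ⊥-elim (x∉p Vec.here)
  x∉p⇒∣q∩[p∪⁅x⁆]∣≡∣q∩p∣+[x∈q] {x = Fin.zero}  {p = outside ∷ p} {inside ∷ q}  _ =
    trans (cong (suc ∘ ∣_∣ ∘ (q ∩_)) (∪-identityʳ p)) (+-comm 1 _)
  x∉p⇒∣q∩[p∪⁅x⁆]∣≡∣q∩p∣+[x∈q] {x = Fin.zero}  {p = outside ∷ p} {outside ∷ q} _ =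
    trans (cong (∣_∣ ∘ (q ∩_)) (∪-identityʳ p)) (sym (+-identityʳ _))
  x∉p⇒∣q∩[p∪⁅x⁆]∣≡∣q∩p∣+[x∈q] {x = Fin.suc _} {p = inside ∷ _}  {inside ∷ q}  x∉p =
    cong suc (x∉p⇒∣q∩[p∪⁅x⁆]∣≡∣q∩p∣+[x∈q] {q = q} (x∉p ∘ Vec.there))
  x∉p⇒∣q∩[p∪⁅x⁆]∣≡∣q∩p∣+[x∈q] {x = Fin.suc _} {p = outside ∷ _} {inside ∷ q}  x∉p =
    x∉p⇒∣q∩[p∪⁅x⁆]∣≡∣q∩p∣+[x∈q] {q = q} (x∉p ∘ Vec.there)
  x∉p⇒∣q∩[p∪⁅x⁆]∣≡∣q∩p∣+[x∈q] {x = Fin.suc _} {p = _ ∷ _}       {outside ∷ q} x∉p =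
    x∉p⇒∣q∩[p∪⁅x⁆]∣≡∣q∩p∣+[x∈q] {q = q} (x∉p ∘ Vec.there)

  subset-of-sizes : ∀ (p q : Subset k) {a b} → a ≤ ∣ p ∩ q ∣ → b ≤ ∣ p ─ q ∣ →
                 ∃ λ z → z ⊆ p × ∣ z ∩ q ∣ ≡ a × ∣ z ─ q ∣ ≡ b
  subset-of-sizes []            []            z≤n      z≤n      = [] , id , refl , refl
  subset-of-sizes (outside ∷ p) (inside ∷ q)  a≤       b≤       =
    let z , z⊆p , ∣z∩q∣ , ∣z─q∣ = subset-of-sizes p q a≤ b≤ in outside ∷ z , out⊆ z⊆p , ∣z∩q∣ , ∣z─q∣
  subset-of-sizes (outside ∷ p) (outside ∷ q) a≤       b≤       =
    let z , z⊆p , ∣z∩q∣ , ∣z─q∣ = subset-of-sizes p q a≤ b≤ in outside ∷ z , out⊆ z⊆p , ∣z∩q∣ , ∣z─q∣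
  subset-of-sizes (inside ∷ p)  (inside ∷ q)  z≤n      b≤       =
    let z , z⊆p , ∣z∩q∣ , ∣z─q∣ = subset-of-sizes p q z≤n b≤ in outside ∷ z , out⊆ z⊆p , ∣z∩q∣ , ∣z─q∣
  subset-of-sizes (inside ∷ p)  (inside ∷ q)  (s≤s a≤) b≤       =
    let z , z⊆p , ∣z∩q∣ , ∣z─q∣ = subset-of-sizes p q a≤ b≤ in inside ∷ z , in⊆in z⊆p , cong suc ∣z∩q∣ , ∣z─q∣
  subset-of-sizes (inside ∷ p)  (outside ∷ q) a≤       z≤n      =
    let z , z⊆p , ∣z∩q∣ , ∣z─q∣ = subset-of-sizes p q a≤ z≤n in outside ∷ z , out⊆ z⊆p , ∣z∩q∣ , ∣z─q∣
  subset-of-sizes (inside ∷ p)  (outside ∷ q) a≤       (s≤s b≤) =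
    let z , z⊆p , ∣z∩q∣ , ∣z─q∣ = subset-of-sizes p q a≤ b≤ in inside ∷ z , in⊆in z⊆p , ∣z∩q∣ , cong suc ∣z─q∣

  subset-of-size : ∀ (p : Subset k) {m} → m ≤ ∣ p ∣ → ∃ λ z → z ⊆ p × ∣ z ∣ ≡ m
  subset-of-size p {m} m≤∣p∣ with subset-of-sizes p p (subst (m ≤_) (cong ∣_∣ (sym (∩-idem p))) m≤∣p∣) z≤n
  ... | z , z⊆p , ∣z∩p∣ , ∣z─p∣ =
    z , z⊆p , trans (∣p∣≡∣p∩q∣+∣p─q∣ z p) (trans (cong₂ _+_ ∣z∩p∣ ∣z─p∣) (+-identityʳ m))

  ∈-allSubsets : ∀ (p : Subset k) → p List.∈ allSubsets k
  ∈-allSubsets []            = Any.here refl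
  ∈-allSubsets (inside ∷ p)  = ∈-++⁺ˡ (∈-map⁺ (inside ∷_) (∈-allSubsets p))
  ∈-allSubsets (outside ∷ p) = ∈-++⁺ʳ _ (∈-map⁺ (outside ∷_) (∈-allSubsets p))

  x∈⋃⁻ : ∀ (ps : List (Subset k)) → x ∈ ⋃ ps → Any (x ∈_) ps
  x∈⋃⁻ []       x∈⋃ = ⊥-elim (∉⊥ x∈⋃)
  x∈⋃⁻ (p ∷ ps) x∈⋃ = [ Any.here , Any.there ∘ x∈⋃⁻ ps ]′ (x∈p∪q⁻ p (⋃ ps) x∈⋃)

  x∈⋃⁺ : ∀ {ps : List (Subset k)} → Any (x ∈_) ps → x ∈ ⋃ ps
  x∈⋃⁺ (Any.here x∈p)  = x∈p∪q⁺ (inj₁ x∈p)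
  x∈⋃⁺ (Any.there x∈⋃) = x∈p∪q⁺ (inj₂ (x∈⋃⁺ x∈⋃))

-- Elementary split matroids

module ElementarySplit {d n : ℕ} (E : ElementarySplitData d n) where

  open ElementarySplitData E
  open MatroidOps indep

  private
    variable
      m : ℕ

  indep⁻ : ∀ X → T (indep X) → ∣ X ∣ ≤ n × (∀ i → ∣ X ∩ H i ∣ ≤ r i)
  indep⁻ _ t = let small , each = to T-∧ t in
    ≤ᵇ⇒≤ _ _ small , λ i → ≤ᵇ⇒≤ _ _ (All.lookup (allᵇ⇒All (allFin q) each) (∈-allFin i))

  indep⁺ : ∀ X → ∣ X ∣ ≤ n → (∀ i → ∣ X ∩ H i ∣ ≤ r i) → T (indep X)
  indep⁺ _ small each = from T-∧ (≤⇒≤ᵇ small , All⇒allᵇ {xs = allFin q} (All.tabulate λ {i} _ → ≤⇒≤ᵇ (each i)))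

  indep-⊆ : ∀ Y X → Y ⊆ X → T (indep X) → T (indep Y)
  indep-⊆ Y X Y⊆X iX = let small , each = indep⁻ X iX in
    indep⁺ Y (≤-trans (p⊆q⇒∣p∣≤∣q∣ Y⊆X) small)
           (λ i → ≤-trans (p⊆q⇒∣p∣≤∣q∣ (λ x∈ → let y , h = x∈p∩q⁻ Y (H i) x∈ in x∈p∩q⁺ (Y⊆X y , h))) (each i))

  -- For k ≢ i: |Z ∩ H k| ≤ |H i ∩ H k| + |Z ─ H i| ≤ (r i + r k − n) + (n − r i) = r k.
  indep-split : ∀ Z i → ∣ Z ∩ H i ∣ ≤ r i → ∣ Z ─ H i ∣ + r i ≤ n → T (indep Z)
  indep-split Z i inside≤ outside≤ = indep⁺ Z small each
    where
    small : ∣ Z ∣ ≤ n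
    small = begin
      ∣ Z ∣                       ≡⟨ ∣p∣≡∣p∩q∣+∣p─q∣ Z (H i) ⟩
      ∣ Z ∩ H i ∣ + ∣ Z ─ H i ∣   ≤⟨ +-monoˡ-≤ _ inside≤ ⟩
      r i + ∣ Z ─ H i ∣           ≡⟨ +-comm (r i) _ ⟩
      ∣ Z ─ H i ∣ + r i           ≤⟨ outside≤ ⟩
      n                           ∎
      where open ≤-Reasoning
    each : ∀ k → ∣ Z ∩ H k ∣ ≤ r k
    each k with k Fin.≟ i
    ... | yes refl = inside≤
    ... | no  k≢i  = ≤-from-budget (∣p∩r∣≤∣q∩r∣+∣p─q∣ Z (H i) (H k)) (H-inter i k (k≢i ∘ sym)) outside≤

  indepSubsetᵇ : Subset d → Subset d → Bool
  indepSubsetᵇ X Y = (Y ⊆ᵇ X) ∧ indep Y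

  rank-≥ : ∀ X Y → Y ⊆ X → T (indep Y) → ∣ Y ∣ ≤ rank X
  rank-≥ X Y Y⊆X iY = ≤-foldr-⊔
    (∈-map⁺ ∣_∣ (∈-filter⁺ (T? ∘ indepSubsetᵇ X) (∈-allSubsets Y) (from T-∧ (⊆⇒⊆ᵇ Y⊆X , iY))))

  rank-≤ : ∀ X → (∀ Y → Y ⊆ X → T (indep Y) → ∣ Y ∣ ≤ m) → rank X ≤ m
  rank-≤ X bound = foldr-⊔-≤ (AllP.map⁺ (All.map (λ {Y} t → let Y⊆ᵇX , iY = to T-∧ t in bound Y (⊆ᵇ⇒⊆ Y⊆ᵇX) iY)
                                                 (all-filter (T? ∘ indepSubsetᵇ X) (allSubsets d))))

  rank≤n : ∀ X → rank X ≤ n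
  rank≤n X = rank-≤ X λ Y _ iY → proj₁ (indep⁻ Y iY)

  rank≤∣X∣ : ∀ X → rank X ≤ ∣ X ∣
  rank≤∣X∣ X = rank-≤ X λ _ Y⊆X _ → p⊆q⇒∣p∣≤∣q∣ Y⊆X

  rank-split-≥ : ∀ X i {a b} → a ≤ r i → a ≤ ∣ X ∩ H i ∣ → b ≤ ∣ X ─ H i ∣ → b + r i ≤ n → a + b ≤ rank X
  rank-split-≥ X i a≤r a≤ b≤ b+r≤n =
    let Z , Z⊆X , ∣Z∩H∣ , ∣Z─H∣ = subset-of-sizes X (H i) a≤ b≤ in
    subst (_≤ rank X) (trans (∣p∣≡∣p∩q∣+∣p─q∣ Z (H i)) (cong₂ _+_ ∣Z∩H∣ ∣Z─H∣))
      (rank-≥ X Z Z⊆X (indep-split Z i (subst (_≤ r i) (sym ∣Z∩H∣) a≤r)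
                                         (subst (λ t → t + r i ≤ n) (sym ∣Z─H∣) b+r≤n)))

  indep-⊆H⁻ : ∀ i Y → Y ⊆ H i → T (indep Y) → ∣ Y ∣ ≤ r i
  indep-⊆H⁻ i Y Y⊆H iY = ≤-trans (p⊆q⇒∣p∣≤∣q∣ (λ y∈Y → x∈p∩q⁺ (y∈Y , Y⊆H y∈Y))) (proj₂ (indep⁻ Y iY) i)

  indep-⊆H⁺ : ∀ i Y → Y ⊆ H i → ∣ Y ∣ ≤ r i → T (indep Y)
  indep-⊆H⁺ i Y Y⊆H ∣Y∣≤r = indep-split Y i (≤-trans (∣p∩q∣≤∣p∣ Y (H i)) ∣Y∣≤r)
    (subst (λ t → t + r i ≤ n) (sym (p⊆q⇒∣p─q∣≡0 Y⊆H)) (<⇒≤ (r-bound i)))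

  rank-⊆H : ∀ i X → X ⊆ H i → r i ≤ ∣ X ∣ → rank X ≡ r i
  rank-⊆H i X X⊆H r≤∣X∣ = ≤-antisym
    (rank-≤ X λ Y Y⊆X iY → indep-⊆H⁻ i Y (⊆-trans Y⊆X X⊆H) iY)
    (let Z , Z⊆X , ∣Z∣ = subset-of-size X r≤∣X∣ in
     subst (_≤ rank X) ∣Z∣ (rank-≥ X Z Z⊆X (indep-⊆H⁺ i Z (⊆-trans Z⊆X X⊆H) (≤-reflexive ∣Z∣))))

  HCircuit : Fin q → Subset d → Set
  HCircuit i C = C ⊆ H i × ∣ C ∣ ≡ suc (r i)

  rank-HCircuit : ∀ i C → HCircuit i C → rank C ≡ r i
  rank-HCircuit i C (C⊆H , ∣C∣) = rank-⊆H i C C⊆H (≤-trans (n≤1+n _) (≤-reflexive (sym ∣C∣)))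

  isCircuit⁻ : ∀ C → T (isCircuit C) → ¬ T (indep C) × (∀ {x} → x ∈ C → T (indep (C - x)))
  isCircuit⁻ C t = let dep , minimal = to T-∧ t in
    T-not⇒¬T dep ,
    λ {x} x∈C → [ (λ x∉C → ⊥-elim (T-not⇒¬T x∉C (∈⇒∈ᵇ x∈C))) , id ]′
                  (to T-∨ (All.lookup (allᵇ⇒All (allFin d) minimal) (∈-allFin x)))

  isCircuit⁺ : ∀ C → ¬ T (indep C) → (∀ {x} → x ∈ C → T (indep (C - x))) → T (isCircuit C)
  isCircuit⁺ C dep minimal =
    from T-∧ (¬T⇒T-not dep , All⇒allᵇ {xs = allFin d} (All.tabulate λ {x} _ → from T-∨ (minimal? x)))
    where
    minimal? : ∀ x → T (not (x ∈ᵇ C)) ⊎ T (indep (C - x))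
    minimal? x with x ∈? C
    ... | yes x∈C = inj₂ (minimal x∈C)
    ... | no  x∉C = inj₁ (¬T⇒T-not (x∉C ∘ ∈ᵇ⇒∈))

  dependent⇒violated : ∀ C → ¬ T (indep C) → ∣ C ∣ ≤ n → ∃ λ i → r i < ∣ C ∩ H i ∣
  dependent⇒violated C dep ∣C∣≤n =
    let i , violated = ¬∀⟶∃¬ q _ (λ i → ∣ C ∩ H i ∣ ≤? r i) (dep ∘ indep⁺ C ∣C∣≤n) in i , ≰⇒> violated

  isCircuit⇒HCircuit : ∀ C → T (isCircuit C) → ∣ C ∣ ≤ n → ∃ λ i → HCircuit i C
  isCircuit⇒HCircuit C t ∣C∣≤n with dependent⇒violated C (proj₁ (isCircuit⁻ C t)) ∣C∣≤n
  ... | i , r<∣C∩H∣ = i , C⊆H , ≤-antisym ∣C∣≤1+r (≤-trans r<∣C∩H∣ (∣p∩q∣≤∣p∣ C (H i)))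
    where
    minimal : ∀ {x} → x ∈ C → T (indep (C - x))
    minimal = proj₂ (isCircuit⁻ C t)

    -- Removing a point outside H i would leave the violation of H i in place.
    C⊆H : C ⊆ H i
    C⊆H {x} x∈C with x ∈? H i
    ... | yes x∈H = x∈H
    ... | no  x∉H = ⊥-elim (<⇒≱ r<∣C∩H∣ (≤-trans (p⊆q⇒∣p∣≤∣q∣ C∩H⊆C-x) (proj₂ (indep⁻ (C - x) (minimal x∈C)) i)))
      where
      C∩H⊆C-x : C ∩ H i ⊆ (C - x) ∩ H i
      C∩H⊆C-x y∈ = let y∈C , y∈H = x∈p∩q⁻ C (H i) y∈ in
        x∈p∩q⁺ (x∈p∧x≢y⇒x∈p-y y∈C (λ { refl → x∉H y∈H }) , y∈H)

    ∣C∣≤1+r : ∣ C ∣ ≤ suc (r i)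
    ∣C∣≤1+r = let x , x∈C = 0<∣p∣⇒Nonempty (≤-trans (s≤s z≤n) (≤-trans r<∣C∩H∣ (∣p∩q∣≤∣p∣ C (H i)))) in
      subst (_≤ suc (r i)) (sym (x∈p⇒∣p∣≡suc∣p-x∣ x∈C))
            (s≤s (indep-⊆H⁻ i (C - x) (⊆-trans (p─q⊆p C ⁅ x ⁆) C⊆H) (minimal x∈C)))

  HCircuit⇒isCircuit : ∀ i C → HCircuit i C → T (isCircuit C)
  HCircuit⇒isCircuit i C (C⊆H , ∣C∣) = isCircuit⁺ C
    (λ iC → 1+n≰n (subst (_≤ r i) ∣C∣ (indep-⊆H⁻ i C C⊆H iC)))
    (λ {x} x∈C → indep-⊆H⁺ i (C - x) (⊆-trans (p─q⊆p C ⁅ x ⁆) C⊆H)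
                   (≤-reflexive (suc-injective (trans (sym (x∈p⇒∣p∣≡suc∣p-x∣ x∈C)) ∣C∣))))

  smallCircuitᵇ : Subset d → Subset d → Bool
  smallCircuitᵇ S C = (C ⊆ᵇ S) ∧ isCircuit C ∧ (∣ C ∣ ≤ᵇ rank S)

  ∈-smallCircuits⁻ : ∀ S C → C List.∈ smallCircuits S → ∃ λ i → HCircuit i C × C ⊆ S
  ∈-smallCircuits⁻ S C C∈ =
    let C⊆ᵇS , circuit,small = to T-∧ (proj₂ (∈-filter⁻ (T? ∘ smallCircuitᵇ S) {xs = allSubsets d} C∈))
        circuit , small = to T-∧ circuit,small
        i , hc = isCircuit⇒HCircuit C circuit (≤-trans (≤ᵇ⇒≤ _ _ small) (rank≤n S))
    in i , hc , ⊆ᵇ⇒⊆ C⊆ᵇS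

  ∈-smallCircuits⁺ : ∀ S i C → rank S ≡ n → HCircuit i C → C ⊆ S → C List.∈ smallCircuits S
  ∈-smallCircuits⁺ S i C rankS≡n hc C⊆S =
    ∈-filter⁺ (T? ∘ smallCircuitᵇ S) (∈-allSubsets C)
      (from T-∧ (⊆⇒⊆ᵇ C⊆S , from T-∧ (HCircuit⇒isCircuit i C hc , ≤⇒≤ᵇ ∣C∣≤rankS)))
    where
    ∣C∣≤rankS : ∣ C ∣ ≤ rank S
    ∣C∣≤rankS = subst₂ _≤_ (sym (proj₂ hc)) (sym rankS≡n) (r-bound i)

  rank-extend : ∀ i C x → HCircuit i C → rank (C ∪ ⁅ x ⁆) ≡ rank C ⇔ x ∈ H i
  rank-extend i C x hc@(C⊆H , ∣C∣) = mk⇔ stays⇒∈H ∈H⇒stays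
    where
    r≤∣C∣ : r i ≤ ∣ C ∣
    r≤∣C∣ = ≤-trans (n≤1+n _) (≤-reflexive (sym ∣C∣))

    ∈H⇒stays : x ∈ H i → rank (C ∪ ⁅ x ⁆) ≡ rank C
    ∈H⇒stays x∈H = trans (rank-⊆H i (C ∪ ⁅ x ⁆) C∪x⊆H (≤-trans r≤∣C∣ (∣p∣≤∣p∪q∣ C ⁅ x ⁆)))
                         (sym (rank-HCircuit i C hc))
      where
      C∪x⊆H : C ∪ ⁅ x ⁆ ⊆ H i
      C∪x⊆H y∈ = [ C⊆H , (λ y∈⁅x⁆ → subst (_∈ H i) (sym (x∈⁅y⁆⇒x≡y x y∈⁅x⁆)) x∈H) ]′ (x∈p∪q⁻ C ⁅ x ⁆ y∈)

    stays⇒∈H : rank (C ∪ ⁅ x ⁆) ≡ rank C → x ∈ H i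
    stays⇒∈H stays with x ∈? H i
    ... | yes x∈H = x∈H
    ... | no  x∉H = ⊥-elim (<⇒≢ grows (sym (trans stays (rank-HCircuit i C hc))))
      where
      C⊆C∪x∩H : C ⊆ (C ∪ ⁅ x ⁆) ∩ H i
      C⊆C∪x∩H y∈C = x∈p∩q⁺ (p⊆p∪q ⁅ x ⁆ y∈C , C⊆H y∈C)
      x∈C∪x─H : x ∈ (C ∪ ⁅ x ⁆) ─ H i
      x∈C∪x─H = x∈p∧x∉q⇒x∈p─q (q⊆p∪q C ⁅ x ⁆ (x∈⁅x⁆ x)) x∉H
      grows : r i < rank (C ∪ ⁅ x ⁆)
      grows = subst (_≤ rank (C ∪ ⁅ x ⁆)) (+-comm (r i) 1)
        (rank-split-≥ (C ∪ ⁅ x ⁆) i ≤-refl (≤-trans r≤∣C∣ (p⊆q⇒∣p∣≤∣q∣ C⊆C∪x∩H)) (x∈p⇒0<∣p∣ x∈C∪x─H) (r-bound i))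

  cl-HCircuit : ∀ S i C → HCircuit i C → cl S C ≡ H i ∩ S
  cl-HCircuit S i C hc = trans (tabulate-cong pointwise) (tabulate∘lookup (H i ∩ S))
    where
    stays⇔∈H : ∀ x → (rank (C ∪ ⁅ x ⁆) ≡ᵇ rank C) ≡ x ∈ᵇ H i
    stays⇔∈H x = T-injective (mk⇔ (∈⇒∈ᵇ ∘ to (rank-extend i C x hc) ∘ ≡ᵇ⇒≡ _ _)
                                   (≡⇒≡ᵇ _ _ ∘ from (rank-extend i C x hc) ∘ ∈ᵇ⇒∈))
    pointwise : ∀ x → (x ∈ᵇ S) ∧ (rank (C ∪ ⁅ x ⁆) ≡ᵇ rank C) ≡ lookup (H i ∩ S) x
    pointwise x = begin
      (x ∈ᵇ S) ∧ (rank (C ∪ ⁅ x ⁆) ≡ᵇ rank C) ≡⟨ cong ((x ∈ᵇ S) ∧_) (stays⇔∈H x) ⟩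
      (x ∈ᵇ S) ∧ (x ∈ᵇ H i)                   ≡⟨ ∧-comm (x ∈ᵇ S) _ ⟩
      (x ∈ᵇ H i) ∧ (x ∈ᵇ S)                   ≡⟨ lookup-zipWith _∧_ x (H i) S ⟨
      lookup (H i ∩ S) x                      ∎
      where open ≡-Reasoning

  Active : Subset d → Fin q → Set
  Active S i = r i < ∣ H i ∩ S ∣

  active? : ∀ S → Decidable (Active S)
  active? S i = r i <? ∣ H i ∩ S ∣

  HCircuit⇒Active : ∀ S i C → HCircuit i C → C ⊆ S → Active S i
  HCircuit⇒Active S i C (C⊆H , ∣C∣) C⊆S =
    subst (_≤ ∣ H i ∩ S ∣) ∣C∣ (p⊆q⇒∣p∣≤∣q∣ (λ y∈C → x∈p∩q⁺ (C⊆H y∈C , C⊆S y∈C)))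

  HCircuit-through : ∀ S i x → Active S i → x ∈ H i ∩ S → ∃ λ D → HCircuit i D × D ⊆ S × x ∈ D
  HCircuit-through S i x active x∈H∩S with subset-of-size (H i ∩ S - x) r≤∣H∩S-x∣
    where
    r≤∣H∩S-x∣ : r i ≤ ∣ H i ∩ S - x ∣
    r≤∣H∩S-x∣ = s≤s⁻¹ (subst (suc (r i) ≤_) (x∈p⇒∣p∣≡suc∣p-x∣ x∈H∩S) active)
  ... | Z , Z⊆H∩S-x , ∣Z∣ =
    Z ∪ ⁅ x ⁆ , (p∩q⊆p (H i) S ∘ D⊆H∩S , ∣D∣) , p∩q⊆q (H i) S ∘ D⊆H∩S , q⊆p∪q Z ⁅ x ⁆ (x∈⁅x⁆ x)
    where
    x∉Z : x ∉ Z
    x∉Z x∈Z = x∈p─q⇒x∉q (Z⊆H∩S-x x∈Z) (x∈⁅x⁆ x)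
    D⊆H∩S : Z ∪ ⁅ x ⁆ ⊆ H i ∩ S
    D⊆H∩S y∈ = [ p─q⊆p (H i ∩ S) ⁅ x ⁆ ∘ Z⊆H∩S-x
               , (λ y∈⁅x⁆ → subst (_∈ H i ∩ S) (sym (x∈⁅y⁆⇒x≡y x y∈⁅x⁆)) x∈H∩S) ]′ (x∈p∪q⁻ Z ⁅ x ⁆ y∈)
    ∣D∣ : ∣ Z ∪ ⁅ x ⁆ ∣ ≡ suc (r i)
    ∣D∣ = trans (x∉p⇒∣p∪⁅x⁆∣≡suc∣p∣ x∉Z) (cong suc ∣Z∣)

  classPoints-HCircuit : ∀ S i C → rank S ≡ n → HCircuit i C → C ⊆ S → classPoints S C ≡ H i ∩ S
  classPoints-HCircuit S i C rankS≡n hc C⊆S = ⊆-antisym classPoints⊆ ⊆classPoints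
    where
    sameClass? : ∀ D → Dec (cl S D ≡ cl S C)
    sameClass? D = ≡-dec Bool._≟_ (cl S D) (cl S C)
    sameClass : Subset d → Bool
    sameClass D = does (sameClass? D)

    classPoints⊆ : classPoints S C ⊆ H i ∩ S
    classPoints⊆ x∈ =
      let D , D∈ , x∈D = find (x∈⋃⁻ _ x∈)
          D∈small , same = ∈-filter⁻ (T? ∘ sameClass) {xs = smallCircuits S} D∈
          k , hcD , D⊆S = ∈-smallCircuits⁻ S D D∈small
      in subst (_ ∈_) (trans (sym (cl-HCircuit S k D hcD)) (trans (T-does⁻ (sameClass? D) same) (cl-HCircuit S i C hc)))
               (x∈p∩q⁺ (proj₁ hcD x∈D , D⊆S x∈D))

    ⊆classPoints : H i ∩ S ⊆ classPoints S C
    ⊆classPoints {x} x∈ =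
      let D , hcD , D⊆S , x∈D = HCircuit-through S i x (HCircuit⇒Active S i C hc C⊆S) x∈ in
      x∈⋃⁺ (Any.map (λ { refl → x∈D })
        (∈-filter⁺ (T? ∘ sameClass) (∈-smallCircuits⁺ S i D rankS≡n hcD D⊆S)
                   (T-does⁺ (sameClass? D) (trans (cl-HCircuit S i D hcD) (sym (cl-HCircuit S i C hc))))))

  classPoints≡cl : ∀ S C → rank S ≡ n → C List.∈ smallCircuits S → classPoints S C ≡ cl S C
  classPoints≡cl S C rankS≡n C∈ = let i , hc , C⊆S = ∈-smallCircuits⁻ S C C∈ in
    trans (classPoints-HCircuit S i C rankS≡n hc C⊆S) (sym (cl-HCircuit S i C hc))

  H∩-injective : ∀ S i k → Active S i → H i ∩ S ≡ H k ∩ S → i ≡ k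
  H∩-injective S i k active eq with i Fin.≟ k
  ... | yes i≡k = i≡k
  ... | no  i≢k = ⊥-elim (<⇒≱ active (<⇒≤ (≤-<-trans ∣H∩S∣≤∣Hi∩Hk∣ ∣Hi∩Hk∣<r)))
    where
    ∣H∩S∣≤∣Hi∩Hk∣ : ∣ H i ∩ S ∣ ≤ ∣ H i ∩ H k ∣
    ∣H∩S∣≤∣Hi∩Hk∣ = p⊆q⇒∣p∣≤∣q∣ λ y∈ →
      x∈p∩q⁺ (p∩q⊆p (H i) S y∈ , p∩q⊆p (H k) S (subst (_ ∈_) eq y∈))
    ∣Hi∩Hk∣<r : ∣ H i ∩ H k ∣ < r i
    ∣Hi∩Hk∣<r = +-cancelʳ-< n _ (r i) (≤-<-trans (H-inter i k i≢k) (+-monoʳ-< (r i) (r-bound k)))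

  activeIndices : Subset d → List (Fin q)
  activeIndices S = filter (active? S) (allFin q)

  hSubspace : Subset d → Fin q → Subset d × ℕ
  hSubspace S i = H i ∩ S , r i

  subspace-HCircuit : ∀ S i C → rank S ≡ n → HCircuit i C → C ⊆ S → (classPoints S C , rank C) ≡ hSubspace S i
  subspace-HCircuit S i C rankS≡n hc C⊆S =
    cong₂ _,_ (classPoints-HCircuit S i C rankS≡n hc C⊆S) (rank-HCircuit i C hc)

  ∈-subspaces⁻ : ∀ S {l} → rank S ≡ n → l List.∈ subspaces S → ∃ λ i → Active S i × l ≡ hSubspace S i
  ∈-subspaces⁻ S rankS≡n l∈ with ∈-map⁻ _ l∈
  ... | C , C∈ , refl =
    let i , hc , C⊆S = ∈-smallCircuits⁻ S C (∈-deduplicate⁻ _ (smallCircuits S) C∈)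
    in i , HCircuit⇒Active S i C hc C⊆S , subspace-HCircuit S i C rankS≡n hc C⊆S

  HCircuit⇒∈subspaces : ∀ S i C → rank S ≡ n → HCircuit i C → C ⊆ S → hSubspace S i List.∈ subspaces S
  HCircuit⇒∈subspaces S i C rankS≡n hc C⊆S =
    let D , D∈ , clD≡clC = find (AnyP.deduplicate⁺ _ (λ eq₁ eq₂ → trans eq₁ eq₂)
                                  (Any.map (cong (cl S) ∘ sym) (∈-smallCircuits⁺ S i C rankS≡n hc C⊆S)))
        k , hcD , D⊆S = ∈-smallCircuits⁻ S D (∈-deduplicate⁻ _ (smallCircuits S) D∈)
    in subst (List._∈ subspaces S)
             (trans (subspace-HCircuit S k D rankS≡n hcD D⊆S)
                    (cong (hSubspace S) (H∩-injective S k i (HCircuit⇒Active S k D hcD D⊆S)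
                      (trans (sym (cl-HCircuit S k D hcD)) (trans clD≡clC (cl-HCircuit S i C hc))))))
             (∈-map⁺ _ D∈)

  ∈-subspaces⁺ : ∀ S i → rank S ≡ n → Active S i → hSubspace S i List.∈ subspaces S
  ∈-subspaces⁺ S i rankS≡n active =
    let C , C⊆H∩S , ∣C∣ = subset-of-size (H i ∩ S) active in
    HCircuit⇒∈subspaces S i C rankS≡n (p∩q⊆p (H i) S ∘ C⊆H∩S , ∣C∣) (p∩q⊆q (H i) S ∘ C⊆H∩S)

  subspaces-unique : ∀ S → rank S ≡ n → Unique (subspaces S)
  subspaces-unique S rankS≡n = AllPairs-map-within distinct
    (All.tabulate (∈-deduplicate⁻ _ (smallCircuits S)))
    (deduplicate-! (On.decSetoid (≡.decSetoid (≡-dec Bool._≟_)) (cl S)) (smallCircuits S))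
    where
    distinct : ∀ {C D} → C List.∈ smallCircuits S → D List.∈ smallCircuits S → cl S C ≢ cl S D →
               (classPoints S C , rank C) ≢ (classPoints S D , rank D)
    distinct {C} {D} C∈ D∈ clC≢clD eq = clC≢clD
      (trans (sym (classPoints≡cl S C rankS≡n C∈)) (trans (cong proj₁ eq) (classPoints≡cl S D rankS≡n D∈)))

  hSubspaces-unique : ∀ S → Unique (map (hSubspace S) (activeIndices S))
  hSubspaces-unique S = AllPairs-map-within distinct
    (all-filter (active? S) (allFin q))
    (Unique.filter⁺ (active? S) (Unique.allFin⁺ q))
    where
    distinct : ∀ {i k} → Active S i → Active S k → i ≢ k → hSubspace S i ≢ hSubspace S k
    distinct {i} {k} active _ i≢k = i≢k ∘ H∩-injective S i k active ∘ cong proj₁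

  subspaces↭ : ∀ S → rank S ≡ n → subspaces S ↭ map (hSubspace S) (activeIndices S)
  subspaces↭ S rankS≡n = ∼bag⇒↭ (unique∧set⇒bag (subspaces-unique S rankS≡n) (hSubspaces-unique S) (mk⇔ ⇒ ⇐))
    where
    ⇒ : ∀ {l} → l List.∈ subspaces S → l List.∈ map (hSubspace S) (activeIndices S)
    ⇒ l∈ with ∈-subspaces⁻ S rankS≡n l∈
    ... | i , active , refl = ∈-map⁺ _ (∈-filter⁺ (active? S) (∈-allFin i) active)
    ⇐ : ∀ {l} → l List.∈ map (hSubspace S) (activeIndices S) → l List.∈ subspaces S
    ⇐ l∈ with ∈-map⁻ _ l∈
    ... | i , i∈ , refl = ∈-subspaces⁺ S i rankS≡n (proj₂ (∈-filter⁻ (active? S) {xs = allFin q} i∈))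

  subspaces-indep : ∀ S → T (indep S) → subspaces S ≡ []
  subspaces-indep S indepS = cong (λ Cs → map (λ C → classPoints S C , rank C)
                                                (deduplicate (λ C D → ≡-dec Bool._≟_ (cl S C) (cl S D)) Cs))
    (filter-none (T? ∘ smallCircuitᵇ S) (All.universal noCircuit (allSubsets d)))
    where
    noCircuit : ∀ C → ¬ T (smallCircuitᵇ S C)
    noCircuit C t = let C⊆ᵇS , circuit,small = to T-∧ t in
      proj₁ (isCircuit⁻ C (proj₁ (to T-∧ circuit,small))) (indep-⊆ C S (⊆ᵇ⇒⊆ C⊆ᵇS) indepS)

  activeIndices-indep : ∀ S → T (indep S) → activeIndices S ≡ []
  activeIndices-indep S indepS = filter-none (active? S) (All.universal inactive (allFin q))
    where
    inactive : ∀ i → ¬ Active S i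
    inactive i active = <⇒≱ active (subst (_≤ r i) (cong ∣_∣ (∩-comm S (H i))) (proj₂ (indep⁻ S indepS) i))

  -- r i points of H i ∩ S and n ∸ r i points of H k ∩ S outside H i are independent; the latter
  -- exist since |H k ∩ S| > r k ≥ |H i ∩ H k| + n − r i.
  rank-∪-hSubspaces : ∀ S i k → i ≢ k → Active S i → Active S k → rank ((H i ∩ S) ∪ (H k ∩ S)) ≡ n
  rank-∪-hSubspaces S i k i≢k active-i active-k = ≤-antisym (rank≤n U)
    (subst (_≤ rank U) (m+[n∸m]≡n (<⇒≤ (r-bound i)))
      (rank-split-≥ U i ≤-refl r≤∣U∩Hi∣ (m≤n+o⇒m∸n≤o n (r i) (subst (n ≤_) (+-comm _ (r i)) n≤∣U─Hi∣+r))
                    (≤-reflexive (m∸n+n≡m (<⇒≤ (r-bound i))))))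
    where
    U : Subset d
    U = (H i ∩ S) ∪ (H k ∩ S)
    r≤∣U∩Hi∣ : r i ≤ ∣ U ∩ H i ∣
    r≤∣U∩Hi∣ = ≤-trans (<⇒≤ active-i) (p⊆q⇒∣p∣≤∣q∣ λ y∈ → x∈p∩q⁺ (p⊆p∪q (H k ∩ S) y∈ , p∩q⊆p (H i) S y∈))
    r<∣U∩Hk∣ : r k < ∣ U ∩ H k ∣
    r<∣U∩Hk∣ = ≤-trans active-k (p⊆q⇒∣p∣≤∣q∣ λ y∈ → x∈p∩q⁺ (q⊆p∪q (H i ∩ S) (H k ∩ S) y∈ , p∩q⊆p (H k) S y∈))
    n≤∣U─Hi∣+r : n ≤ ∣ U ─ H i ∣ + r i
    n≤∣U─Hi∣+r with n ≤? ∣ U ─ H i ∣ + r i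
    ... | yes n≤ = n≤
    ... | no  n≰ = ⊥-elim (<⇒≱ r<∣U∩Hk∣
      (≤-from-budget (∣p∩r∣≤∣q∩r∣+∣p─q∣ U (H i) (H k)) (H-inter i k i≢k) (<⇒≤ (≰⇒> n≰))))

  rank-∪-subspaces : ∀ S → rank S ≡ n → ∀ {l₁ l₂} → l₁ List.∈ subspaces S → l₂ List.∈ subspaces S → l₁ ≢ l₂ →
                     rank (proj₁ l₁ ∪ proj₁ l₂) ≡ n
  rank-∪-subspaces S rankS≡n l₁∈ l₂∈ l₁≢l₂ with ∈-subspaces⁻ S rankS≡n l₁∈ | ∈-subspaces⁻ S rankS≡n l₂∈
  ... | i , active-i , refl | k , active-k , refl =
    rank-∪-hSubspaces S i k (λ { refl → l₁≢l₂ refl }) active-i active-k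

-- Orderings of the ground set

module Ordering {d : ℕ} (indep : Subset d → Bool) (w : Fin d → Fin d) (w-injective : Injective _≡_ _≡_ w) where

  open MatroidOps indep using (firstPoints)

  ∈-firstPoints⁻ : ∀ m {x} → x ∈ firstPoints w m → ∃ λ j → toℕ j < m × w j ≡ x
  ∈-firstPoints⁻ m x∈ with find (x∈⋃⁻ _ x∈)
  ... | _ , S∈ , x∈S with ∈-map⁻ (λ k → ⁅ w k ⁆) S∈
  ... | j , j∈ , refl =
    j , <ᵇ⇒< _ _ (proj₂ (∈-filter⁻ (T? ∘ λ k → toℕ k <ᵇ m) {xs = allFin d} j∈)) , sym (x∈⁅y⁆⇒x≡y (w j) x∈S)

  ∈-firstPoints⁺ : ∀ {m} j → toℕ j < m → w j ∈ firstPoints w m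
  ∈-firstPoints⁺ {m} j j<m = x∈⋃⁺ (Any.map (λ { refl → x∈⁅x⁆ (w j) })
    (∈-map⁺ (λ k → ⁅ w k ⁆) (∈-filter⁺ (T? ∘ λ k → toℕ k <ᵇ m) (∈-allFin j) (<⇒<ᵇ j<m))))

  firstPoints-mono : ∀ {m m′} → m ≤ m′ → firstPoints w m ⊆ firstPoints w m′
  firstPoints-mono {m} m≤m′ x∈ with ∈-firstPoints⁻ m x∈
  ... | j , j<m , refl = ∈-firstPoints⁺ j (≤-trans j<m m≤m′)

  firstPoints-zero : firstPoints w 0 ≡ ⊥
  firstPoints-zero = Empty-unique λ (_ , x∈) → n≮0 (proj₁ (proj₂ (∈-firstPoints⁻ 0 x∈)))

  w∉firstPoints : ∀ j → w j ∉ firstPoints w (toℕ j)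
  w∉firstPoints j wj∈ = let k , k<j , wk≡wj = ∈-firstPoints⁻ (toℕ j) wj∈ in
    <-irrefl (cong toℕ (w-injective wk≡wj)) k<j

  firstPoints-suc : ∀ j → firstPoints w (suc (toℕ j)) ≡ firstPoints w (toℕ j) ∪ ⁅ w j ⁆
  firstPoints-suc j = ⊆-antisym ⊆∪ ∪⊆
    where
    ⊆∪ : firstPoints w (suc (toℕ j)) ⊆ firstPoints w (toℕ j) ∪ ⁅ w j ⁆
    ⊆∪ x∈ with ∈-firstPoints⁻ (suc (toℕ j)) x∈
    ... | k , k<1+j , refl = [ (λ k<j → p⊆p∪q ⁅ w j ⁆ (∈-firstPoints⁺ k k<j))
                             , (λ k≡j → q⊆p∪q _ ⁅ w j ⁆
                                          (subst (λ l → w k ∈ ⁅ w l ⁆) (toℕ-injective k≡j) (x∈⁅x⁆ (w k)))) ]′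
                             (m<1+n⇒m<n∨m≡n k<1+j)
    ∪⊆ : firstPoints w (toℕ j) ∪ ⁅ w j ⁆ ⊆ firstPoints w (suc (toℕ j))
    ∪⊆ x∈ = [ firstPoints-mono (n≤1+n _)
            , (λ x∈⁅wj⁆ → subst (_∈ _) (sym (x∈⁅y⁆⇒x≡y (w j) x∈⁅wj⁆)) (∈-firstPoints⁺ j ≤-refl)) ]′
            (x∈p∪q⁻ _ ⁅ w j ⁆ x∈)

  ∣firstPoints∣ : ∀ m → m ≤ d → ∣ firstPoints w m ∣ ≡ m
  ∣firstPoints∣ zero    _     = trans (cong ∣_∣ firstPoints-zero) (∣⊥∣≡0 d)
  ∣firstPoints∣ (suc m) 1+m≤d = begin
    ∣ firstPoints w (suc m) ∣            ≡⟨ cong (∣_∣ ∘ firstPoints w ∘ suc) toℕj≡m ⟨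
    ∣ firstPoints w (suc (toℕ j)) ∣      ≡⟨ cong ∣_∣ (firstPoints-suc j) ⟩
    ∣ firstPoints w (toℕ j) ∪ ⁅ w j ⁆ ∣  ≡⟨ x∉p⇒∣p∪⁅x⁆∣≡suc∣p∣ (w∉firstPoints j) ⟩
    suc ∣ firstPoints w (toℕ j) ∣        ≡⟨ cong (suc ∘ ∣_∣ ∘ firstPoints w) toℕj≡m ⟩
    suc ∣ firstPoints w m ∣              ≡⟨ cong suc (∣firstPoints∣ m (<⇒≤ 1+m≤d)) ⟩
    suc m                                ∎
    where
    open ≡-Reasoning
    j : Fin d
    j = Fin.fromℕ< 1+m≤d
    toℕj≡m : toℕ j ≡ m
    toℕj≡m = toℕ-fromℕ< 1+m≤d

  firstPoints-all : firstPoints w d ≡ ⊤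
  firstPoints-all = ∣p∣≡n⇒p≡⊤ (∣firstPoints∣ d ≤-refl)

  ∣X∩firstPoints-suc∣ : ∀ X j →
    ∣ X ∩ firstPoints w (suc (toℕ j)) ∣ ≡ ∣ X ∩ firstPoints w (toℕ j) ∣ + (if w j ∈ᵇ X then 1 else 0)
  ∣X∩firstPoints-suc∣ X j = trans (cong (∣_∣ ∘ (X ∩_)) (firstPoints-suc j))
                                  (x∉p⇒∣q∩[p∪⁅x⁆]∣≡∣q∩p∣+[x∈q] {q = X} (w∉firstPoints j))

-- Integer sums

module _ where

  open import Data.Integer using (+_)

  sumℤ-↭ : ∀ {xs ys} → xs ↭ ys → sumℤ xs ≡ sumℤ ys
  sumℤ-↭ xs↭ys = foldr-commMonoid (≡.setoid ℤ) ℤ.+-0-isCommutativeMonoid (↭⇒↭ₛ xs↭ys)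

  sumℤ-cong : ∀ {A : Set} {f g : A → ℤ} → (∀ x → f x ≡ g x) → ∀ xs → sumℤ (map f xs) ≡ sumℤ (map g xs)
  sumℤ-cong f≗g xs = cong sumℤ (map-cong f≗g xs)

  sumℤ-filter : ∀ {A : Set} {P : A → Set} (P? : Decidable P) (f : A → ℤ) xs →
                sumℤ (map f (filter P? xs)) ≡ sumℤ (map (λ x → if does (P? x) then f x else + 0) xs)
  sumℤ-filter P? f []       = refl
  sumℤ-filter P? f (x ∷ xs) with does (P? x)
  ... | true  = cong (ℤ._+_ (f x)) (sumℤ-filter P? f xs)
  ... | false = trans (sumℤ-filter P? f xs) (sym (ℤ.+-identityˡ _))

  sumℤ-distrib-+ : ∀ {A : Set} (f g : A → ℤ) xs →
                   sumℤ (map (λ x → f x ℤ.+ g x) xs) ≡ sumℤ (map f xs) ℤ.+ sumℤ (map g xs)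
  sumℤ-distrib-+ f g []       = refl
  sumℤ-distrib-+ f g (x ∷ xs) =
    trans (cong (ℤ._+_ (f x ℤ.+ g x)) (sumℤ-distrib-+ f g xs)) (regroup (f x) (g x) _ _)
    where
    regroup : ∀ a b c e → a ℤ.+ b ℤ.+ (c ℤ.+ e) ≡ a ℤ.+ c ℤ.+ (b ℤ.+ e)
    regroup = solve-∀

  sumℤ-distrib-─ : ∀ {A : Set} (f g : A → ℤ) xs →
                   sumℤ (map (λ x → f x ℤ.- g x) xs) ≡ sumℤ (map f xs) ℤ.- sumℤ (map g xs)
  sumℤ-distrib-─ f g []       = refl
  sumℤ-distrib-─ f g (x ∷ xs) =
    trans (cong (ℤ._+_ (f x ℤ.- g x)) (sumℤ-distrib-─ f g xs)) (regroup (f x) (g x) _ _)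
    where
    regroup : ∀ a b c e → a ℤ.- b ℤ.+ (c ℤ.- e) ≡ a ℤ.+ c ℤ.- (b ℤ.+ e)
    regroup = solve-∀

  sumℤ-const : ∀ {A : Set} c (xs : List A) → sumℤ (map (λ _ → + c) xs) ≡ + (c * length xs)
  sumℤ-const c []       = cong +_ (sym (*-zeroʳ c))
  sumℤ-const c (_ ∷ xs) = begin
    + c ℤ.+ sumℤ (map (λ _ → + c) xs)  ≡⟨ cong (ℤ._+_ (+ c)) (sumℤ-const c xs) ⟩
    + c ℤ.+ + (c * length xs)          ≡⟨ ℤ.pos-+ c (c * length xs) ⟨
    + (c + c * length xs)              ≡⟨ cong +_ (*-suc c (length xs)) ⟨
    + (c * suc (length xs))            ∎
    where open ≡-Reasoning

  sumℤ-comm : ∀ {A B : Set} (f : A → B → ℤ) xs ys →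
              sumℤ (map (λ x → sumℤ (map (f x) ys)) xs) ≡ sumℤ (map (λ y → sumℤ (map (λ x → f x y) xs)) ys)
  sumℤ-comm f []       ys = sym (trans (sumℤ-const 0 ys) (cong +_ (*-zeroˡ (length ys))))
  sumℤ-comm f (x ∷ xs) ys =
    trans (cong (ℤ._+_ (sumℤ (map (f x) ys))) (sumℤ-comm f xs ys)) (sym (sumℤ-distrib-+ (f x) _ ys))

  sumℤ-telescope : ∀ k (g : ℕ → ℤ) → sumℤ (map (λ j → g (suc (toℕ j)) ℤ.- g (toℕ j)) (allFin k)) ≡ g k ℤ.- g 0
  sumℤ-telescope k g = trans (cong sumℤ (map-tabulate {n = k} id _)) (sumℤ-tabulate-telescope k g)
    where
    sumℤ-tabulate-telescope : ∀ k (g : ℕ → ℤ) →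
                              sumℤ (tabulate (λ (j : Fin k) → g (suc (toℕ j)) ℤ.- g (toℕ j))) ≡ g k ℤ.- g 0
    sumℤ-tabulate-telescope zero    g = sym (ℤ.+-inverseʳ (g 0))
    sumℤ-tabulate-telescope (suc k) g =
      trans (cong (ℤ._+_ (g 1 ℤ.- g 0)) (sumℤ-tabulate-telescope k (g ∘ suc))) (cancel (g 0) (g 1) (g (suc k)))
      where
      cancel : ∀ a b c → b ℤ.- a ℤ.+ (c ℤ.- b) ≡ c ℤ.- a
      cancel = solve-∀

  -- The increment of m ↦ κ * (m ∸ r) along one step c ↦ c + [b] of a counter is κ exactly when
  -- the step passes r.
  threshold-step : ∀ (κ : ℤ) r c b →
    (if does (r <? c ℕ.+ (if b then 1 else 0)) ∧ b then κ else + 0)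
      ≡ κ ℤ.* + (c ℕ.+ (if b then 1 else 0) ∸ r) ℤ.- κ ℤ.* + (c ∸ r)
  threshold-step κ r c false = begin
    (if does (r <? c ℕ.+ 0) ∧ false then κ else + 0)
      ≡⟨ cong (λ t → if t then κ else + 0) (∧-zeroʳ _) ⟩
    + 0
      ≡⟨ ℤ.+-inverseʳ (κ ℤ.* + (c ∸ r)) ⟨
    κ ℤ.* + (c ∸ r) ℤ.- κ ℤ.* + (c ∸ r)
      ≡⟨ cong (λ m → κ ℤ.* + (m ∸ r) ℤ.- κ ℤ.* + (c ∸ r)) (+-identityʳ c) ⟨
    κ ℤ.* + (c ℕ.+ 0 ∸ r) ℤ.- κ ℤ.* + (c ∸ r)
      ∎
    where open ≡-Reasoning
  threshold-step κ r c true with r ≤? c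
  ... | yes r≤c = begin
    (if does (r <? c ℕ.+ 1) ∧ true then κ else + 0)
      ≡⟨ cong (λ t → if t ∧ true then κ else + 0) (dec-true (r <? c ℕ.+ 1) r<c+1) ⟩
    κ
      ≡⟨ increment κ (+ (c ∸ r)) ⟩
    κ ℤ.* (+ (c ∸ r) ℤ.+ + 1) ℤ.- κ ℤ.* + (c ∸ r)
      ≡⟨ cong (λ t → κ ℤ.* t ℤ.- κ ℤ.* + (c ∸ r)) c+1∸r ⟨
    κ ℤ.* + (c ℕ.+ 1 ∸ r) ℤ.- κ ℤ.* + (c ∸ r)
      ∎
    where
    open ≡-Reasoning
    r<c+1 : r < c ℕ.+ 1
    r<c+1 = subst (r <_) (+-comm 1 c) (s≤s r≤c)
    c+1∸r : + (c ℕ.+ 1 ∸ r) ≡ + (c ∸ r) ℤ.+ + 1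
    c+1∸r = trans (cong +_ (+-∸-comm 1 r≤c)) (ℤ.pos-+ (c ∸ r) 1)
    increment : ∀ a x → a ≡ a ℤ.* (x ℤ.+ + 1) ℤ.- a ℤ.* x
    increment = solve-∀
  ... | no  r≰c = begin
    (if does (r <? c ℕ.+ 1) ∧ true then κ else + 0)
      ≡⟨ cong (λ t → if t ∧ true then κ else + 0) (dec-false (r <? c ℕ.+ 1) r≮c+1) ⟩
    + 0
      ≡⟨ ℤ.+-inverseʳ (κ ℤ.* + 0) ⟨
    κ ℤ.* + 0 ℤ.- κ ℤ.* + 0
      ≡⟨ cong₂ (λ m m′ → κ ℤ.* + m ℤ.- κ ℤ.* + m′) (m≤n⇒m∸n≡0 c+1≤r) (m≤n⇒m∸n≡0 (<⇒≤ (≰⇒> r≰c))) ⟨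
    κ ℤ.* + (c ℕ.+ 1 ∸ r) ℤ.- κ ℤ.* + (c ∸ r)
      ∎
    where
    open ≡-Reasoning
    c+1≤r : c ℕ.+ 1 ≤ r
    c+1≤r = subst (_≤ r) (+-comm 1 c) (≰⇒> r≰c)
    r≮c+1 : ¬ r < c ℕ.+ 1
    r≮c+1 r<c+1 = r≰c (s≤s⁻¹ (subst (r <_) (+-comm c 1) r<c+1))

-- Summing τ̃ along a good ordering

module _ {d : ℕ} (indep : Subset d → Bool) where

  open import Data.Integer using (+_)
  open MatroidOps indep

  corank : ℕ → Subset d × ℕ → ℤ
  corank n l = + n ℤ.- + proj₂ l

  τ-unfold : ∀ {n w j ls} → Lp w j ≡ ls →
             τ n w j ≡ sumℤ (map (λ l → + proj₂ l) ls) ℤ.- + n ℤ.* (+ length ls ℤ.- + 1)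
  τ-unfold refl = refl

  τ̃≡n-∑corank : ∀ n w j → length (Lp w j) ≤ 2 →
                (∀ l₁ l₂ → Lp w j ≡ l₁ ∷ l₂ ∷ [] → rank (proj₁ l₁ ∪ proj₁ l₂) ≡ n) →
                τ̃ n w j ≡ + n ℤ.- sumℤ (map (corank n) (Lp w j))
  τ̃≡n-∑corank n w j ∣Lp∣≤2 spanning with Lp w j in Lp≡
  ... | []                = trans (τ-unfold {n} Lp≡) (none (+ n))
    where
    none : ∀ a → + 0 ℤ.- a ℤ.* (+ 0 ℤ.- + 1) ≡ a ℤ.- + 0
    none = solve-∀
  ... | l ∷ []            = trans (τ-unfold {n} Lp≡) (one (+ n) (+ proj₂ l))
    where
    one : ∀ a x → (x ℤ.+ + 0) ℤ.- a ℤ.* (+ 1 ℤ.- + 1) ≡ a ℤ.- ((a ℤ.- x) ℤ.+ + 0)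
    one = solve-∀
  ... | l₁ ∷ l₂ ∷ []      = trans (cong (λ ρ → + proj₂ l₁ ℤ.+ + proj₂ l₂ ℤ.- + ρ) (spanning l₁ l₂ refl))
                                  (two (+ n) (+ proj₂ l₁) (+ proj₂ l₂))
    where
    two : ∀ a x y → x ℤ.+ y ℤ.- a ≡ a ℤ.- ((a ℤ.- x) ℤ.+ ((a ℤ.- y) ℤ.+ + 0))
    two = solve-∀
  ... | _ ∷ _ ∷ _ ∷ _     with ∣Lp∣≤2
  ...   | s≤s (s≤s ())

module ElementarySplitOrdering {d n : ℕ} (E : ElementarySplitData d n) where

  open import Data.Integer using (+_)
  open ElementarySplitData E
  open MatroidOps indep
  open ElementarySplit E

  module Ordered (rank-full : rank full ≡ n) (w : Fin d → Fin d) (good : GoodOrdering n w) where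

    open Ordering indep w (proj₁ good)

    indep-basis : T (indep (firstPoints w n))
    indep-basis = proj₁ (proj₁ (proj₂ good))

    n≤d : n ≤ d
    n≤d = subst (_≤ d) rank-full (≤-trans (rank≤∣X∣ full) (∣p∣≤n full))

    rank-prefix : ∀ j → n ≤ toℕ j → rank (prefix w j) ≡ n
    rank-prefix j n≤j = ≤-antisym (rank≤n (prefix w j))
      (subst (_≤ rank (prefix w j)) (∣firstPoints∣ n n≤d)
        (rank-≥ (prefix w j) (firstPoints w n) (firstPoints-mono (m≤n⇒m≤1+n n≤j)) indep-basis))

    indep-prefix : ∀ j → toℕ j < n → T (indep (prefix w j))
    indep-prefix j j<n = indep-⊆ (prefix w j) (firstPoints w n) (firstPoints-mono j<n) indep-basis

    Lp-empty : ∀ j → toℕ j < n → Lp w j ≡ []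
    Lp-empty j j<n = cong (filterᵇ (λ l → w j ∈ᵇ proj₁ l)) (subspaces-indep (prefix w j) (indep-prefix j j<n))

    subspaces-prefix↭ : ∀ j → subspaces (prefix w j) ↭ map (hSubspace (prefix w j)) (activeIndices (prefix w j))
    subspaces-prefix↭ j with toℕ j <? n
    ... | yes j<n = subst₂ _↭_ (sym (subspaces-indep (prefix w j) (indep-prefix j j<n)))
                               (sym (cong (map _) (activeIndices-indep (prefix w j) (indep-prefix j j<n)))) ↭-refl
    ... | no  j≮n = subspaces↭ (prefix w j) (rank-prefix j (≮⇒≥ j≮n))

    ∣Lp∣≤2 : ∀ j → length (Lp w j) ≤ 2
    ∣Lp∣≤2 j with toℕ j <? n
    ... | yes j<n = subst (λ ls → length ls ≤ 2) (sym (Lp-empty j j<n)) z≤n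
    ... | no  j≮n = proj₂ (proj₂ good) j (≮⇒≥ j≮n)

    Lp-spanning : ∀ j l₁ l₂ → Lp w j ≡ l₁ ∷ l₂ ∷ [] → rank (proj₁ l₁ ∪ proj₁ l₂) ≡ n
    Lp-spanning j l₁ l₂ Lp≡ with toℕ j <? n
    ... | yes j<n = contradiction (trans (sym (Lp-empty j j<n)) Lp≡) λ ()
    ... | no  j≮n = rank-∪-subspaces S (rank-prefix j (≮⇒≥ j≮n))
                      (∈Lp⇒∈subspaces (Any.here refl)) (∈Lp⇒∈subspaces (Any.there (Any.here refl)))
                      (All.head (AllPairs.head (subst Unique Lp≡ Lp-unique)))
      where
      S : Subset d
      S = prefix w j
      ∋p : Subset d × ℕ → Bool
      ∋p l = w j ∈ᵇ proj₁ l
      ∈Lp⇒∈subspaces : ∀ {l} → l List.∈ l₁ ∷ l₂ ∷ [] → l List.∈ subspaces S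
      ∈Lp⇒∈subspaces l∈ = proj₁ (∈-filter⁻ (T? ∘ ∋p) {xs = subspaces S} (subst (_ List.∈_) (sym Lp≡) l∈))
      Lp-unique : Unique (Lp w j)
      Lp-unique = Unique.filter⁺ (T? ∘ ∋p) (subspaces-unique S (rank-prefix j (≮⇒≥ j≮n)))

    κ : Fin q → ℤ
    κ i = + n ℤ.- + r i

    -- H i ∩ {p₁,…,p_{j+1}} is a subspace of M_w[j+1] containing p_{j+1} = w j.
    through : Fin d → Fin q → Bool
    through j i = does (active? (prefix w j) i) ∧ (w j ∈ᵇ (H i ∩ prefix w j))

    ∑corank-Lp : ∀ j → sumℤ (map (corank indep n) (Lp w j))
                       ≡ sumℤ (map (λ i → if through j i then κ i else + 0) (allFin q))
    ∑corank-Lp j = begin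
      sumℤ (map (corank indep n) (Lp w j))
        ≡⟨ sumℤ-↭ (map⁺ (corank indep n) (filter-↭ (T? ∘ ∋p) (subspaces-prefix↭ j))) ⟩
      sumℤ (map (corank indep n) (filterᵇ ∋p (map (hSubspace S) (activeIndices S))))
        ≡⟨ sumℤ-filter (T? ∘ ∋p) (corank indep n) (map (hSubspace S) (activeIndices S)) ⟩
      sumℤ (map (λ l → if ∋p l then corank indep n l else + 0) (map (hSubspace S) (activeIndices S)))
        ≡⟨ cong sumℤ (map-∘ (activeIndices S)) ⟨
      sumℤ (map (λ i → if ∋p (hSubspace S i) then κ i else + 0) (activeIndices S))
        ≡⟨ sumℤ-filter (active? S) _ (allFin q) ⟩
      sumℤ (map (λ i → if does (active? S i) then (if ∋p (hSubspace S i) then κ i else + 0) else + 0) (allFin q))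
        ≡⟨ sumℤ-cong (λ i → if-∧ (does (active? S i))) (allFin q) ⟨
      sumℤ (map (λ i → if through j i then κ i else + 0) (allFin q))
        ∎
      where
      open ≡-Reasoning
      S : Subset d
      S = prefix w j
      ∋p : Subset d × ℕ → Bool
      ∋p l = w j ∈ᵇ proj₁ l

    -- p_{j+1} lies on the subspace H i ∩ {p₁,…,p_{j+1}} exactly when it is one of the points of H i
    -- that come after the first r i of them.
    ∑through : ∀ i → sumℤ (map (λ j → if through j i then κ i else + 0) (allFin d)) ≡ κ i ℤ.* + (∣ H i ∣ ∸ r i)
    ∑through i = begin
      sumℤ (map (λ j → if through j i then κ i else + 0) (allFin d))  ≡⟨ sumℤ-cong step (allFin d) ⟩
      sumℤ (map (λ j → G (suc (toℕ j)) ℤ.- G (toℕ j)) (allFin d))    ≡⟨ sumℤ-telescope d G ⟩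
      G d ℤ.- G 0                                                    ≡⟨ cong₂ ℤ._-_ G-end G-start ⟩
      κ i ℤ.* + (∣ H i ∣ ∸ r i) ℤ.- + 0                              ≡⟨ ℤ.+-identityʳ _ ⟩
      κ i ℤ.* + (∣ H i ∣ ∸ r i)                                      ∎
      where
      open ≡-Reasoning
      c : ℕ → ℕ
      c m = ∣ H i ∩ firstPoints w m ∣
      G : ℕ → ℤ
      G m = κ i ℤ.* + (c m ∸ r i)
      [wj∈H] : Fin d → ℕ
      [wj∈H] j = if w j ∈ᵇ H i then 1 else 0
      wj∈ᵇH∩prefix : ∀ j → w j ∈ᵇ (H i ∩ prefix w j) ≡ w j ∈ᵇ H i
      wj∈ᵇH∩prefix j = trans (lookup-zipWith _∧_ (w j) (H i) (prefix w j))
        (trans (cong (w j ∈ᵇ H i ∧_) (to T-≡ (∈⇒∈ᵇ (∈-firstPoints⁺ j ≤-refl)))) (∧-identityʳ _))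
      step : ∀ j → (if through j i then κ i else + 0) ≡ G (suc (toℕ j)) ℤ.- G (toℕ j)
      step j = begin
        (if through j i then κ i else + 0)
          ≡⟨ cong₂ (λ m b → if does (r i <? m) ∧ b then κ i else + 0)
                   (∣X∩firstPoints-suc∣ (H i) j) (wj∈ᵇH∩prefix j) ⟩
        (if does (r i <? c (toℕ j) ℕ.+ [wj∈H] j) ∧ (w j ∈ᵇ H i) then κ i else + 0)
          ≡⟨ threshold-step (κ i) (r i) (c (toℕ j)) (w j ∈ᵇ H i) ⟩
        κ i ℤ.* + (c (toℕ j) ℕ.+ [wj∈H] j ∸ r i) ℤ.- G (toℕ j)
          ≡⟨ cong (λ m → κ i ℤ.* + (m ∸ r i) ℤ.- G (toℕ j)) (∣X∩firstPoints-suc∣ (H i) j) ⟨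
        G (suc (toℕ j)) ℤ.- G (toℕ j)
          ∎
      G-end : G d ≡ κ i ℤ.* + (∣ H i ∣ ∸ r i)
      G-end = cong (λ X → κ i ℤ.* + (∣ X ∣ ∸ r i)) (trans (cong (H i ∩_) firstPoints-all) (∩-identityʳ (H i)))
      G-start : G 0 ≡ + 0
      G-start = begin
        κ i ℤ.* + (∣ H i ∩ firstPoints w 0 ∣ ∸ r i)
          ≡⟨ cong (λ X → κ i ℤ.* + (∣ H i ∩ X ∣ ∸ r i)) firstPoints-zero ⟩
        κ i ℤ.* + (∣ H i ∩ ⊥ ∣ ∸ r i)
          ≡⟨ cong (λ m → κ i ℤ.* + (m ∸ r i)) (trans (cong ∣_∣ (∩-zeroʳ (H i))) (∣⊥∣≡0 d)) ⟩
        κ i ℤ.* + (0 ∸ r i)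
          ≡⟨ cong (λ m → κ i ℤ.* + m) (0∸n≡0 (r i)) ⟩
        κ i ℤ.* + 0
          ≡⟨ ℤ.*-zeroʳ (κ i) ⟩
        + 0
          ∎

    naiveDim≡ : naiveDim n ≡ + (n * d) ℤ.- sumℤ (map (λ i → κ i ℤ.* + (∣ H i ∣ ∸ r i)) (allFin q))
    naiveDim≡ = cong (ℤ._-_ (+ (n * d))) (begin
      sumℤ (map F (subspaces full))
        ≡⟨ sumℤ-↭ (map⁺ F (subspaces↭ full rank-full)) ⟩
      sumℤ (map F (map (hSubspace full) (activeIndices full)))
        ≡⟨ cong (λ is → sumℤ (map F (map (hSubspace full) is))) all-active ⟩
      sumℤ (map F (map (hSubspace full) (allFin q)))
        ≡⟨ cong sumℤ (map-∘ (allFin q)) ⟨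
      sumℤ (map (F ∘ hSubspace full) (allFin q))
        ≡⟨ sumℤ-cong F-hSubspace (allFin q) ⟩
      sumℤ (map (λ i → κ i ℤ.* + (∣ H i ∣ ∸ r i)) (allFin q))
        ∎)
      where
      open ≡-Reasoning
      F : Subset d × ℕ → ℤ
      F l = (+ ∣ proj₁ l ∣ ℤ.- + proj₂ l) ℤ.* (+ n ℤ.- + proj₂ l)
      H∩full : ∀ i → H i ∩ full ≡ H i
      H∩full i = trans (cong (H i ∩_) full≡⊤) (∩-identityʳ (H i))
        where
        full≡⊤ : full ≡ ⊤
        full≡⊤ = ⊆-antisym ⊆⊤ (λ {x} _ → ∈ᵇ⇒∈ (subst T (sym (lookup∘tabulate (λ _ → true) x)) _))
      all-active : activeIndices full ≡ allFin q
      all-active = filter-all (active? full)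
        (All.universal (λ i → subst (r i <_) (cong ∣_∣ (sym (H∩full i))) (H-size i)) (allFin q))
      F-hSubspace : ∀ i → F (hSubspace full i) ≡ κ i ℤ.* + (∣ H i ∣ ∸ r i)
      F-hSubspace i = begin
        (+ ∣ H i ∩ full ∣ ℤ.- + r i) ℤ.* κ i  ≡⟨ cong (λ X → (+ ∣ X ∣ ℤ.- + r i) ℤ.* κ i) (H∩full i) ⟩
        (+ ∣ H i ∣ ℤ.- + r i) ℤ.* κ i         ≡⟨ cong (ℤ._* κ i) (trans (ℤ.m-n≡m⊖n _ (r i)) (ℤ.⊖-≥ (<⇒≤ (H-size i)))) ⟩
        + (∣ H i ∣ ∸ r i) ℤ.* κ i             ≡⟨ ℤ.*-comm _ (κ i) ⟩
        κ i ℤ.* + (∣ H i ∣ ∸ r i)             ∎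

lemma4p12 : (d n : ℕ) (E : ElementarySplitData d n)
    → MatroidOps.rank (ElementarySplitData.indep E) (MatroidOps.full (ElementarySplitData.indep E)) ≡ n
    → MatroidOps.InductivelyConnected (ElementarySplitData.indep E) n
    → (w : Fin d → Fin d)
    → MatroidOps.GoodOrdering (ElementarySplitData.indep E) n w
    → sumℤ (map (MatroidOps.τ̃ (ElementarySplitData.indep E) n w) (allFin d))
      ≡ MatroidOps.naiveDim (ElementarySplitData.indep E) n
lemma4p12 d n E rank-full _ w good = begin
  sumℤ (map (τ̃ n w) (allFin d))
    ≡⟨ sumℤ-cong τ̃≡n-∑through (allFin d) ⟩
  sumℤ (map (λ j → + n ℤ.- sumℤ (map (f j) (allFin q))) (allFin d))
    ≡⟨ sumℤ-distrib-─ (λ _ → + n) (λ j → sumℤ (map (f j) (allFin q))) (allFin d) ⟩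
  sumℤ (map (λ _ → + n) (allFin d)) ℤ.- sumℤ (map (λ j → sumℤ (map (f j) (allFin q))) (allFin d))
    ≡⟨ cong₂ ℤ._-_ (trans (sumℤ-const n (allFin d)) (cong (λ m → + (n * m)) (length-tabulate id)))
                   (sumℤ-comm f (allFin d) (allFin q)) ⟩
  + (n * d) ℤ.- sumℤ (map (λ i → sumℤ (map (λ j → f j i) (allFin d))) (allFin q))
    ≡⟨ cong (ℤ._-_ (+ (n * d))) (sumℤ-cong ∑through (allFin q)) ⟩
  + (n * d) ℤ.- sumℤ (map (λ i → κ i ℤ.* + (∣ H i ∣ ∸ r i)) (allFin q))
    ≡⟨ naiveDim≡ ⟨
  naiveDim n ∎
  where
  open import Data.Integer using (+_)
  open ≡-Reasoning
  open ElementarySplitData E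
  open MatroidOps indep
  open ElementarySplitOrdering.Ordered E rank-full w good
  f : Fin d → Fin q → ℤ
  f j i = if through j i then κ i else + 0
  τ̃≡n-∑through : ∀ j → τ̃ n w j ≡ + n ℤ.- sumℤ (map (f j) (allFin q))
  τ̃≡n-∑through j = trans (τ̃≡n-∑corank indep n w j (∣Lp∣≤2 j) (Lp-spanning j)) (cong (ℤ._-_ (+ n)) (∑corank-Lp j))
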